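{- Let $G$ be an affine partial cube and let $E_e$ be a $\Theta$-class of $G$. Then $A(\pi_e(G))=\pi_e(A(G))$.
   Context: A partial cube is a finite graph isometrically embedded in a hypercube $Q_n$ (vertex set $\{+,-\}^n$, adjacency meaning the vectors differ in one coordinate), with $n$ minimal. Basic notions: - The $\Theta$-class $E_e$ consists of the edges whose endpoints differ in coordinate $e$. - The halfspaces $E_e^\pm$ are the induced subgraphs on the vertices with $e$-th coordinate $\pm$. - A partial cube is antipodal if it contains, with each vertex, the vertex with all coordinates flipped. - A partial cube is affine if it is a halfspace of an antipodal partial cube. - The contraction $\pi_e(G)$ identifies the endpoints of every edge of $E_e$. We also write $\pi_e$ for the induced map on vertices. Antipodes. The interval $[u,w]$ is the set of vertices lying on some shortest $u$–$w$ path. The set of antipodes $A(G)$ of $G$ is the set of vertices $u$ for which there exists a vertex $-u$ of $G$ with $[u,-u]=V(G)$. -}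

module Defs where

open import Data.Nat using (ℕ; zero; suc; _+_; _≤_)
open import Data.Bool using (Bool; true; false; not; _≟_)
open import Data.Fin using (Fin)
open import Data.Vec using (Vec; []; _∷_; lookup; removeAt; map)
open import Data.Product using (Σ; ∃; _×_; _,_)
open import Relation.Binary.PropositionalEquality using (_≡_)
open import Relation.Nullary using (yes; no)

-- Vertices of the hypercube Q_k : sign vectors, + encoded as true, - as false.
Cube : ℕ → Set
Cube k = Vec Bool k

ham : ∀ {k} → Cube k → Cube k → ℕ
ham [] [] = 0
ham (x ∷ xs) (y ∷ ys) with x ≟ y
... | yes _ = ham xs ys
... | no  _ = suc (ham xs ys)

record Graph (k : ℕ) : Set₁ where
  field
    Vtx : Cube k → Set
    Adj : Cube k → Cube k → Set
open Graph public

data Walk {k} (G : Graph k) : ℕ → Cube k → Cube k → Set where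
  here : ∀ {u} → Vtx G u → Walk G 0 u u
  step : ∀ {ℓ u v w} → Adj G u v → Walk G ℓ v w → Walk G (suc ℓ) u w

data OnWalk {k} {G : Graph k} (x : Cube k) : ∀ {ℓ u w} → Walk G ℓ u w → Set where
  on-here  : ∀ {p : Vtx G x} → OnWalk x (here p)
  on-start : ∀ {ℓ v w} {a : Adj G x v} {p : Walk G ℓ v w} → OnWalk x (step a p)
  on-later : ∀ {ℓ u v w} {a : Adj G u v} {p : Walk G ℓ v w} → OnWalk x p → OnWalk x (step a p)

Shortest : ∀ {k} (G : Graph k) {ℓ u w} → Walk G ℓ u w → Set
Shortest G {ℓ} {u} {w} _ = ∀ ℓ' → Walk G ℓ' u w → ℓ ≤ ℓ'

Dist : ∀ {k} (G : Graph k) → Cube k → Cube k → ℕ → Set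
Dist G u w ℓ = Σ (Walk G ℓ u w) (Shortest G)

InInterval : ∀ {k} (G : Graph k) → Cube k → Cube k → Cube k → Set
InInterval G u w x = ∃ λ ℓ → Σ (Walk G ℓ u w) λ p → Shortest G p × OnWalk x p

IsAntipode : ∀ {k} (G : Graph k) → Cube k → Set
IsAntipode G u = Vtx G u × ∃ λ v → Vtx G v × (∀ x → Vtx G x → InInterval G u v x)

Induced : ∀ {k} → (Cube k → Set) → Graph k
Induced V = record
  { Vtx = V
  ; Adj = λ u v → V u × V v × ham u v ≡ 1 }

IsPartialCube : ∀ {n} → (Cube n → Set) → Set
IsPartialCube {n} V =
  (∀ u v → V u → V v → Dist (Induced V) u v (ham u v)) ×
  (∀ m (f : Cube n → Cube m) →
     (∀ u v → V u → V v → ∀ ℓ → Dist (Induced V) u v ℓ → ham (f u) (f v) ≡ ℓ) →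
     n ≤ m)

IsAntipodal : ∀ {n} → (Cube n → Set) → Set
IsAntipodal V = ∀ v → V v → V (map not v)

Halfspace : ∀ {m} → (Cube m → Set) → Fin m → Bool → Cube m → Set
Halfspace W f s w = W w × lookup w f ≡ s

record GraphIso {k l} (G : Graph k) (H : Graph l) : Set where
  field
    to      : Cube k → Cube l
    from    : Cube l → Cube k
    to-Vtx  : ∀ u → Vtx G u → Vtx H (to u)
    from-Vtx : ∀ w → Vtx H w → Vtx G (from w)
    from-to : ∀ u → Vtx G u → from (to u) ≡ u
    to-from : ∀ w → Vtx H w → to (from w) ≡ w
    to-Adj  : ∀ u v → Vtx G u → Vtx G v → Adj G u v → Adj H (to u) (to v)
    from-Adj : ∀ u v → Vtx G u → Vtx G v → Adj H (to u) (to v) → Adj G u v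

IsAffine : ∀ {n} → (Cube n → Set) → Set₁
IsAffine {n} V = ∃ λ m → Σ (Cube m → Set) λ W → ∃ λ (f : Fin m) → ∃ λ (s : Bool) →
  IsPartialCube W × IsAntipodal W ×
  GraphIso (Induced V) (Induced (Halfspace W f s))

πv : ∀ {n} → Fin (suc n) → Cube (suc n) → Cube n
πv e u = removeAt u e

-- Contraction π_e(G) of the graph G = Induced V: identify the endpoints of
-- every edge of E_e; the remaining edges become edges between the images.
Contract : ∀ {n} → Fin (suc n) → (Cube (suc n) → Set) → Graph n
Contract e V = record
  { Vtx = λ a → ∃ λ u → V u × πv e u ≡ a
  ; Adj = λ a b → ∃ λ u → ∃ λ v → Adj (Induced V) u v × lookup u e ≡ lookup v e
                    × πv e u ≡ a × πv e v ≡ b }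

{-# OPTIONS --safe #-}
module Submission where

-- Since G is isometric in Q_{n+1}, the contraction π_e maps a geodesic u–v of G onto a walk
-- of length at most ham(π u, π v) in π_e(G); hence π_e(G) is isometric too and antipodes of G
-- project to antipodes. Conversely, if π u and π w are antipodal in π_e(G), they are opposite
-- corners of Q_n: a coordinate on which they agree would be constant on all of G, and deleting it
-- would contradict the minimality of n + 1. If u and w also differ at e, then u is an antipode.
-- Otherwise ham(u, w) = n, and we use that G is a halfspace E_f^s of an antipodal partial cube W:
-- the first vertex q of a W-geodesic from u to −w is at distance n + 1 from w, so either q ∈ G
-- is an antipode projecting to π u, or −q ∈ G lies at distance dim W − 1 ≥ n + 1 from u.

open import Defs
open import Data.Nat using (ℕ; zero; suc; _+_; _≤_; z≤n; s≤s)
open import Data.Nat.Properties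
  using (≤-trans; ≤-refl; ≤-reflexive; ≤-antisym; ≤-pred; n≤1+n; m≤n⇒m≤1+n; n≮n; +-suc; +-identityʳ;
         +-mono-≤; +-monoˡ-≤; +-monoʳ-≤; +-cancelʳ-≡; +-cancelˡ-≤; m+n≤o⇒n≤o; suc-injective)
open import Data.Bool using (Bool; true; false; not; _≟_)
open import Data.Bool.Properties using (not-involutive; ¬-not; not-¬)
open import Data.Fin using (Fin; zero; suc; punchIn)
open import Data.Fin.Properties using (punchInᵢ≢i; punchOut-punchIn)
open import Data.Vec using (Vec; []; _∷_; lookup; removeAt; map)
open import Data.Vec.Properties using (lookup-map; map-∘; map-cong; map-id; removeAt-punchOut)
open import Data.Product using (Σ; ∃; _×_; _,_; proj₁; proj₂)
import Data.Product as Product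
open import Data.Sum using (_⊎_; inj₁; inj₂)
import Data.Sum as Sum
open import Data.Empty using (⊥-elim)
open import Function using (_∘_; id)
open import Relation.Binary.PropositionalEquality
open import Relation.Nullary using (Dec; yes; no; ¬_)

δ : Bool → Bool → ℕ
δ true  true  = 0
δ true  false = 1
δ false true  = 1
δ false false = 0

δ-refl : ∀ b → δ b b ≡ 0
δ-refl true  = refl
δ-refl false = refl

δ≤1 : ∀ b c → δ b c ≤ 1
δ≤1 true  true  = z≤n
δ≤1 true  false = ≤-refl
δ≤1 false true  = ≤-refl
δ≤1 false false = z≤n

≢⇒δ≡1 : ∀ {b c} → b ≢ c → δ b c ≡ 1
≢⇒δ≡1 {true}  {true}  b≢c = ⊥-elim (b≢c refl)
≢⇒δ≡1 {true}  {false} _   = refl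
≢⇒δ≡1 {false} {true}  _   = refl
≢⇒δ≡1 {false} {false} b≢c = ⊥-elim (b≢c refl)

flip : ∀ {k} → Cube k → Cube k
flip = map not

flip-involutive : ∀ {k} (x : Cube k) → flip (flip x) ≡ x
flip-involutive x = trans (sym (map-∘ not not x)) (trans (map-cong not-involutive x) (map-id x))

removeAt-map : ∀ {A B : Set} {k} (f : A → B) (xs : Vec A (suc k)) (j : Fin (suc k)) →
               removeAt (map f xs) j ≡ map f (removeAt xs j)
removeAt-map f (x ∷ xs)     zero    = refl
removeAt-map f (x ∷ y ∷ xs) (suc j) = cong (f x ∷_) (removeAt-map f (y ∷ xs) j)

lookup-removeAt : ∀ {A : Set} {k} (xs : Vec A (suc k)) (e : Fin (suc k)) (i : Fin k) →
                  lookup (removeAt xs e) i ≡ lookup xs (punchIn e i)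
lookup-removeAt xs e i =
  trans (cong (lookup (removeAt xs e)) (sym (punchOut-punchIn e)))
        (removeAt-punchOut xs (punchInᵢ≢i e i ∘ sym))

ham-refl : ∀ {k} (x : Cube k) → ham x x ≡ 0
ham-refl []          = refl
ham-refl (true ∷ x)  = ham-refl x
ham-refl (false ∷ x) = ham-refl x

ham≡0⇒≡ : ∀ {k} (x y : Cube k) → ham x y ≡ 0 → x ≡ y
ham≡0⇒≡ []          []          _  = refl
ham≡0⇒≡ (true ∷ x)  (true ∷ y)  eq = cong (true ∷_) (ham≡0⇒≡ x y eq)
ham≡0⇒≡ (false ∷ x) (false ∷ y) eq = cong (false ∷_) (ham≡0⇒≡ x y eq)
ham≡0⇒≡ (true ∷ x)  (false ∷ y) ()
ham≡0⇒≡ (false ∷ x) (true ∷ y)  ()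

ham-sym : ∀ {k} (x y : Cube k) → ham x y ≡ ham y x
ham-sym []          []          = refl
ham-sym (true ∷ x)  (true ∷ y)  = ham-sym x y
ham-sym (true ∷ x)  (false ∷ y) = cong suc (ham-sym x y)
ham-sym (false ∷ x) (true ∷ y)  = cong suc (ham-sym x y)
ham-sym (false ∷ x) (false ∷ y) = ham-sym x y

ham≤dim : ∀ {k} (x y : Cube k) → ham x y ≤ k
ham≤dim []          []          = z≤n
ham≤dim (true ∷ x)  (true ∷ y)  = m≤n⇒m≤1+n (ham≤dim x y)
ham≤dim (true ∷ x)  (false ∷ y) = s≤s (ham≤dim x y)
ham≤dim (false ∷ x) (true ∷ y)  = s≤s (ham≤dim x y)
ham≤dim (false ∷ x) (false ∷ y) = m≤n⇒m≤1+n (ham≤dim x y)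

s≤+s : ∀ {a b c} → a ≤ b + c → suc a ≤ b + suc c
s≤+s {b = b} {c} le = ≤-trans (s≤s le) (≤-reflexive (sym (+-suc b c)))

ham-triangle : ∀ {k} (x y z : Cube k) → ham x z ≤ ham x y + ham y z
ham-triangle []          []          []          = z≤n
ham-triangle (true ∷ x)  (true ∷ y)  (true ∷ z)  = ham-triangle x y z
ham-triangle (false ∷ x) (false ∷ y) (false ∷ z) = ham-triangle x y z
ham-triangle (true ∷ x)  (true ∷ y)  (false ∷ z) = s≤+s (ham-triangle x y z)
ham-triangle (false ∷ x) (false ∷ y) (true ∷ z)  = s≤+s (ham-triangle x y z)
ham-triangle (true ∷ x)  (false ∷ y) (false ∷ z) = s≤s (ham-triangle x y z)
ham-triangle (false ∷ x) (true ∷ y)  (true ∷ z)  = s≤s (ham-triangle x y z)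
ham-triangle (true ∷ x)  (false ∷ y) (true ∷ z)  = ≤-trans (ham-triangle x y z) (+-mono-≤ (n≤1+n _) (n≤1+n _))
ham-triangle (false ∷ x) (true ∷ y)  (false ∷ z) = ≤-trans (ham-triangle x y z) (+-mono-≤ (n≤1+n _) (n≤1+n _))

ham+ham-flip≡dim : ∀ {k} (x y : Cube k) → ham x y + ham x (flip y) ≡ k
ham+ham-flip≡dim []          []          = refl
ham+ham-flip≡dim (true ∷ x)  (true ∷ y)  = trans (+-suc (ham x y) _) (cong suc (ham+ham-flip≡dim x y))
ham+ham-flip≡dim (true ∷ x)  (false ∷ y) = cong suc (ham+ham-flip≡dim x y)
ham+ham-flip≡dim (false ∷ x) (true ∷ y)  = cong suc (ham+ham-flip≡dim x y)
ham+ham-flip≡dim (false ∷ x) (false ∷ y) = trans (+-suc (ham x y) _) (cong suc (ham+ham-flip≡dim x y))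

ham≡dim⇒≡flip : ∀ {k} (x y : Cube k) → ham x y ≡ k → y ≡ flip x
ham≡dim⇒≡flip []          []          _  = refl
ham≡dim⇒≡flip (true ∷ x)  (false ∷ y) eq = cong (false ∷_) (ham≡dim⇒≡flip x y (suc-injective eq))
ham≡dim⇒≡flip (false ∷ x) (true ∷ y)  eq = cong (true ∷_) (ham≡dim⇒≡flip x y (suc-injective eq))
ham≡dim⇒≡flip {suc k} (true ∷ x)  (true ∷ y)  eq = ⊥-elim (n≮n k (subst (_≤ k) eq (ham≤dim x y)))
ham≡dim⇒≡flip {suc k} (false ∷ x) (false ∷ y) eq = ⊥-elim (n≮n k (subst (_≤ k) eq (ham≤dim x y)))

ham-removeAt : ∀ {k} (x y : Cube (suc k)) (j : Fin (suc k)) →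
               ham x y ≡ δ (lookup x j) (lookup y j) + ham (removeAt x j) (removeAt y j)
ham-removeAt (true ∷ x)  (true ∷ y)  zero = refl
ham-removeAt (true ∷ x)  (false ∷ y) zero = refl
ham-removeAt (false ∷ x) (true ∷ y)  zero = refl
ham-removeAt (false ∷ x) (false ∷ y) zero = refl
ham-removeAt (true ∷ x@(_ ∷ _))  (true ∷ y@(_ ∷ _))  (suc j) = ham-removeAt x y j
ham-removeAt (false ∷ x@(_ ∷ _)) (false ∷ y@(_ ∷ _)) (suc j) = ham-removeAt x y j
ham-removeAt (true ∷ x@(_ ∷ _))  (false ∷ y@(_ ∷ _)) (suc j) =
  trans (cong suc (ham-removeAt x y j)) (sym (+-suc _ _))
ham-removeAt (false ∷ x@(_ ∷ _)) (true ∷ y@(_ ∷ _))  (suc j) =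
  trans (cong suc (ham-removeAt x y j)) (sym (+-suc _ _))

Between : ∀ {k} → Cube k → Cube k → Cube k → Set
Between a x b = ham a x + ham x b ≤ ham a b

between-tail : ∀ {k} a₀ x₀ b₀ (a x b : Cube k) →
               Between (a₀ ∷ a) (x₀ ∷ x) (b₀ ∷ b) → Between a x b
between-tail true  true  true  a x b le = le
between-tail false false false a x b le = le
between-tail true  true  false a x b le = ≤-pred (≤-trans (≤-reflexive (sym (+-suc (ham a x) (ham x b)))) le)
between-tail false false true  a x b le = ≤-pred (≤-trans (≤-reflexive (sym (+-suc (ham a x) (ham x b)))) le)
between-tail true  false false a x b le = ≤-pred le
between-tail false true  true  a x b le = ≤-pred le
between-tail true  false true  a x b le = ≤-trans (+-mono-≤ (n≤1+n _) (n≤1+n _)) le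
between-tail false true  false a x b le = ≤-trans (+-mono-≤ (n≤1+n _) (n≤1+n _)) le

detour-impossible : ∀ {k} (a x b : Cube k) → ¬ suc (ham a x) + suc (ham x b) ≤ ham a b
detour-impossible a x b le =
  n≮n (ham a b) (≤-trans (s≤s (≤-trans (ham-triangle a x b) (+-monoʳ-≤ (ham a x) (n≤1+n _)))) le)

between⇒agree : ∀ {k} (a x b : Cube k) (i : Fin k) → Between a x b →
                lookup a i ≡ lookup b i → lookup x i ≡ lookup a i
between⇒agree (true ∷ a)  (true ∷ x)  (true ∷ b)  zero _  _ = refl
between⇒agree (false ∷ a) (false ∷ x) (false ∷ b) zero _  _ = refl
between⇒agree (true ∷ a)  (false ∷ x) (true ∷ b)  zero le _ = ⊥-elim (detour-impossible a x b le)
between⇒agree (false ∷ a) (true ∷ x)  (false ∷ b) zero le _ = ⊥-elim (detour-impossible a x b le)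
between⇒agree (true ∷ a)  _           (false ∷ b) zero _  ()
between⇒agree (false ∷ a) _           (true ∷ b)  zero _  ()
between⇒agree (a₀ ∷ a) (x₀ ∷ x) (b₀ ∷ b) (suc i) le eq =
  between⇒agree a x b i (between-tail a₀ x₀ b₀ a x b le) eq

ham≡dim⊎agree : ∀ {k} (a b : Cube k) → ham a b ≡ k ⊎ ∃ λ i → lookup a i ≡ lookup b i
ham≡dim⊎agree []          []          = inj₁ refl
ham≡dim⊎agree (true ∷ a)  (true ∷ b)  = inj₂ (zero , refl)
ham≡dim⊎agree (false ∷ a) (false ∷ b) = inj₂ (zero , refl)
ham≡dim⊎agree (true ∷ a)  (false ∷ b) = Sum.map (cong suc) (Product.map suc id) (ham≡dim⊎agree a b)
ham≡dim⊎agree (false ∷ a) (true ∷ b)  = Sum.map (cong suc) (Product.map suc id) (ham≡dim⊎agree a b)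

UnitEdges : ∀ {k} → Graph k → Set
UnitEdges G = ∀ u v → Adj G u v → ham u v ≡ 1

induced-unitEdges : ∀ {k} (V : Cube k → Set) → UnitEdges (Induced V)
induced-unitEdges V u v (_ , _ , uv) = uv

_++ʷ_ : ∀ {k} {G : Graph k} {ℓ₁ ℓ₂ u v w} →
        Walk G ℓ₁ u v → Walk G ℓ₂ v w → Walk G (ℓ₁ + ℓ₂) u w
here _   ++ʷ q = q
step a p ++ʷ q = step a (p ++ʷ q)

onWalk-start : ∀ {k} {G : Graph k} {ℓ u w} (p : Walk G ℓ u w) → OnWalk u p
onWalk-start (here _)   = on-here
onWalk-start (step _ _) = on-start

onWalk-++ʳ : ∀ {k} {G : Graph k} {ℓ₁ ℓ₂ u v w x} (p : Walk G ℓ₁ u v) (q : Walk G ℓ₂ v w) →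
             OnWalk x q → OnWalk x (p ++ʷ q)
onWalk-++ʳ (here _)   q x∈q = x∈q
onWalk-++ʳ (step a p) q x∈q = on-later (onWalk-++ʳ p q x∈q)

onWalk-subst : ∀ {k} {G : Graph k} {ℓ u u′ w x} (eq : u ≡ u′) (p : Walk G ℓ u w) →
               OnWalk x p → OnWalk x (subst (λ z → Walk G ℓ z w) eq p)
onWalk-subst refl p x∈p = x∈p

module _ {k} {G : Graph k} (unit : UnitEdges G) where

  ham-step : ∀ {u v w} → Adj G u v → ham u w ≤ suc (ham v w)
  ham-step {u} {v} {w} a = ≤-trans (ham-triangle u v w) (≤-reflexive (cong (_+ ham v w) (unit u v a)))

  ham≤length : ∀ {ℓ u w} → Walk G ℓ u w → ham u w ≤ ℓ
  ham≤length (here {u} _) = ≤-reflexive (ham-refl u)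
  ham≤length (step a p)   = ≤-trans (ham-step a) (s≤s (ham≤length p))

  onWalk⇒ham+ham≤length : ∀ {ℓ u w x} (p : Walk G ℓ u w) → OnWalk x p → ham u x + ham x w ≤ ℓ
  onWalk⇒ham+ham≤length (here {u} _) on-here rewrite ham-refl u = z≤n
  onWalk⇒ham+ham≤length (step {u = u} a p) on-start rewrite ham-refl u = ham≤length (step a p)
  onWalk⇒ham+ham≤length {x = x} (step {w = w} a p) (on-later x∈p) =
    ≤-trans (+-monoˡ-≤ (ham x w) (ham-step a)) (s≤s (onWalk⇒ham+ham≤length p x∈p))

  length≤ham⇒shortest : ∀ {ℓ u w} (p : Walk G ℓ u w) → ℓ ≤ ham u w → Shortest G p
  length≤ham⇒shortest p ℓ≤ham ℓ′ q = ≤-trans ℓ≤ham (ham≤length q)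

  interval⇒between : ∀ {ℓ a b x} → Walk G ℓ a b → ℓ ≤ ham a b →
                     InInterval G a b x → Between a x b
  interval⇒between p ℓ≤ham (_ , q , q-shortest , x∈q) =
    ≤-trans (onWalk⇒ham+ham≤length q x∈q) (≤-trans (q-shortest _ p) ℓ≤ham)

  geodesic-first-step : ∀ {ℓ u w} → Walk G ℓ u w → ℓ ≤ ham u w → u ≢ w →
                        ∃ λ v → Adj G u v × suc (ham v w) ≡ ham u w
  geodesic-first-step (here _)           _     u≢w = ⊥-elim (u≢w refl)
  geodesic-first-step (step {v = v} a p) ℓ≤ham _   =
    v , a , ≤-antisym (≤-trans (s≤s (ham≤length p)) ℓ≤ham) (ham-step a)

Isometric : ∀ {k} → (Cube k → Set) → Set
Isometric V = ∀ u v → V u → V v → Dist (Induced V) u v (ham u v)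

HamPreserving : ∀ {k m} → (Cube k → Set) → (Cube k → Cube m) → Set
HamPreserving V g = ∀ u v → V u → V v → ham (g u) (g v) ≡ ham u v

module _ {k} {V : Cube k → Set} (isometric : Isometric V) where

  geodesic : ∀ {u v} → V u → V v → Walk (Induced V) (ham u v) u v
  geodesic Vu Vv = proj₁ (isometric _ _ Vu Vv)

  dist≡ham : ∀ {u v ℓ} → V u → V v → Dist (Induced V) u v ℓ → ℓ ≡ ham u v
  dist≡ham Vu Vv (p , p-shortest) =
    ≤-antisym (p-shortest _ (geodesic Vu Vv)) (ham≤length (induced-unitEdges V) p)

  ham≡dim⇒antipode : ∀ {u w} → V u → V w → ham u w ≡ k → IsAntipode (Induced V) u
  ham≡dim⇒antipode {u} {w} Vu Vw uw≡k = Vu , w , Vw , λ y Vy →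
    let p = geodesic Vu Vy ++ʷ geodesic Vy Vw in
    ham u y + ham y w , p , length≤ham⇒shortest (induced-unitEdges V) p (≤-reflexive (via y)) ,
    onWalk-++ʳ (geodesic Vu Vy) _ (onWalk-start _)
    where
    via : ∀ y → ham u y + ham y w ≡ ham u w
    via y = begin
      ham u y + ham y w        ≡⟨ cong₂ _+_ (ham-sym u y) (cong (ham y) (ham≡dim⇒≡flip u w uw≡k)) ⟩
      ham y u + ham y (flip u) ≡⟨ ham+ham-flip≡dim y u ⟩
      k                        ≡⟨ sym uw≡k ⟩
      ham u w                  ∎
      where open ≡-Reasoning

constant-coordinate⇒dim≤ : ∀ {k m} {V : Cube k → Set} {g : Cube k → Cube (suc m)} →
  IsPartialCube V → HamPreserving V g → (j : Fin (suc m)) (b : Bool) →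
  (∀ u → V u → lookup (g u) j ≡ b) → k ≤ m
constant-coordinate⇒dim≤ {m = m} {V} {g} (isometric , minimal) g-ham j b constant =
  minimal m (λ u → removeAt (g u) j) drop-preserves
  where
  open ≡-Reasoning
  drop-preserves : ∀ u v → V u → V v → ∀ ℓ → Dist (Induced V) u v ℓ →
                   ham (removeAt (g u) j) (removeAt (g v) j) ≡ ℓ
  drop-preserves u v Vu Vv ℓ d = begin
    ham (removeAt (g u) j) (removeAt (g v) j)
      ≡⟨ cong (_+ ham (removeAt (g u) j) (removeAt (g v) j))
              (sym (trans (cong₂ δ (constant u Vu) (constant v Vv)) (δ-refl b))) ⟩
    δ (lookup (g u) j) (lookup (g v) j) + ham (removeAt (g u) j) (removeAt (g v) j)
      ≡⟨ sym (ham-removeAt (g u) (g v) j) ⟩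
    ham (g u) (g v)
      ≡⟨ g-ham u v Vu Vv ⟩
    ham u v
      ≡⟨ sym (dist≡ham isometric Vu Vv d) ⟩
    ℓ ∎

module _ {k l} {V : Cube k → Set} {V′ : Cube l → Set} (φ : GraphIso (Induced V) (Induced V′)) where
  open GraphIso φ

  walk-to : ∀ {ℓ u v} → Walk (Induced V) ℓ u v → Walk (Induced V′) ℓ (to u) (to v)
  walk-to (here Vu)                = here (to-Vtx _ Vu)
  walk-to (step a@(Vu , Vv , _) p) = step (to-Adj _ _ Vu Vv a) (walk-to p)

  walk-from : ∀ {ℓ h h′} → Walk (Induced V′) ℓ h h′ → Walk (Induced V) ℓ (from h) (from h′)
  walk-from (here V′h) = here (from-Vtx _ V′h)
  walk-from (step {u = h} {v = h′} a@(V′h , V′h′ , _) p) =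
    step (from-Adj _ _ (from-Vtx h V′h) (from-Vtx h′ V′h′)
                   (subst₂ (Adj (Induced V′)) (sym (to-from h V′h)) (sym (to-from h′ V′h′)) a))
         (walk-from p)

  iso-hamPreserving : Isometric V → Isometric V′ → HamPreserving V to
  iso-hamPreserving isoV isoV′ u v Vu Vv = ≤-antisym
    (ham≤length (induced-unitEdges V′) (walk-to (geodesic isoV Vu Vv)))
    (subst₂ (λ a b → ham a b ≤ ham (to u) (to v)) (from-to u Vu) (from-to v Vv)
            (ham≤length (induced-unitEdges V) (walk-from (geodesic isoV′ (to-Vtx u Vu) (to-Vtx v Vv)))))

module _ {m} {W : Cube m → Set} (f : Fin m) (s : Bool) where

  geodesic-in-halfspace : ∀ {ℓ z y} → Walk (Induced W) ℓ z y → ℓ ≤ ham z y →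
                          lookup z f ≡ s → lookup y f ≡ s → Walk (Induced (Halfspace W f s)) ℓ z y
  geodesic-in-halfspace (here Wz) _ zf _ = here (Wz , zf)
  geodesic-in-halfspace {suc ℓ} {z} {y} (step {v = v} a@(Wz , Wv , zv) p) ℓ≤ham zf yf =
    step ((Wz , zf) , (Wv , vf) , zv) (geodesic-in-halfspace p rest≤ham vf yf)
    where
    rest≤ham : ℓ ≤ ham v y
    rest≤ham = ≤-pred (≤-trans ℓ≤ham (ham-step {G = Induced W} (induced-unitEdges W) a))
    v-between : Between z v y
    v-between rewrite zv = ≤-trans (s≤s (ham≤length (induced-unitEdges W) p)) ℓ≤ham
    vf : lookup v f ≡ s
    vf = trans (between⇒agree z v y f v-between (trans zf (sym yf))) zf

  halfspace-isometric : Isometric W → Isometric (Halfspace W f s)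
  halfspace-isometric isoW u v (Wu , uf) (Wv , vf) =
    p , length≤ham⇒shortest (induced-unitEdges (Halfspace W f s)) p ≤-refl
    where
    p = geodesic-in-halfspace (geodesic isoW Wu Wv) ≤-refl uf vf

halfspace-far-vertex : ∀ {m} {W : Cube (suc m) → Set} {f s z y} → Isometric W → IsAntipodal W →
  Halfspace W f s z → Halfspace W f s y →
  (∃ λ h → Halfspace W f s h × ham h y ≡ suc (ham z y)) ⊎
  (∃ λ h → Halfspace W f s h × ham z h ≡ m)
halfspace-far-vertex {m} {W} {f} {s} {z} {y} isoW antipodal (Wz , zf) (Wy , yf) =
  towards-flip-y
    (geodesic-first-step (induced-unitEdges W) (geodesic isoW Wz (antipodal y Wy)) ≤-refl z≢flip-y)
  where
  open ≡-Reasoning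
  z≢flip-y : z ≢ flip y
  z≢flip-y eq = not-¬ refl (begin
    s                  ≡⟨ sym zf ⟩
    lookup z f         ≡⟨ cong (λ t → lookup t f) eq ⟩
    lookup (flip y) f  ≡⟨ lookup-map f not y ⟩
    not (lookup y f)   ≡⟨ cong not yf ⟩
    not s              ∎)
  towards-flip-y : (∃ λ q → Adj (Induced W) z q × suc (ham q (flip y)) ≡ ham z (flip y)) →
    (∃ λ h → Halfspace W f s h × ham h y ≡ suc (ham z y)) ⊎
    (∃ λ h → Halfspace W f s h × ham z h ≡ m)
  towards-flip-y (q , (_ , Wq , zq) , q-closer) with lookup q f ≟ s
  ... | yes qf = inj₁ (q , (Wq , qf) , +-cancelʳ-≡ (ham q (flip y)) _ _ (begin
    ham q y + ham q (flip y)        ≡⟨ ham+ham-flip≡dim q y ⟩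
    suc m                           ≡⟨ sym (ham+ham-flip≡dim z y) ⟩
    ham z y + ham z (flip y)        ≡⟨ cong (ham z y +_) (sym q-closer) ⟩
    ham z y + suc (ham q (flip y))  ≡⟨ +-suc (ham z y) _ ⟩
    suc (ham z y) + ham q (flip y)  ∎))
  ... | no qf≢s = inj₂ (flip q , (antipodal q Wq , flip-q-in-halfspace) ,
    suc-injective (trans (cong (_+ ham z (flip q)) (sym zq)) (ham+ham-flip≡dim z q)))
    where
    flip-q-in-halfspace : lookup (flip q) f ≡ s
    flip-q-in-halfspace = trans (lookup-map f not q) (sym (¬-not (qf≢s ∘ sym)))

affine-far-vertex : ∀ {n} {V : Cube (suc n) → Set} → IsPartialCube V → IsAffine V →
  ∀ {u w} → V u → V w →
  (∃ λ h → V h × ham h w ≡ suc (ham u w)) ⊎ (∃ λ h → V h × ham u h ≡ suc n)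
affine-far-vertex _ (zero , _ , () , _)
affine-far-vertex {n} {V} pc@(isoV , _) (suc m , W , f , s , (isoW , _) , antipodal , φ) {u} {w} Vu Vw =
  Sum.map far-from-w far-from-u (halfspace-far-vertex isoW antipodal (to-Vtx u Vu) (to-Vtx w Vw))
  where
  open GraphIso φ
  open ≡-Reasoning
  to-ham : HamPreserving V to
  to-ham = iso-hamPreserving φ isoV (halfspace-isometric f s isoW)
  n<m : suc n ≤ m
  n<m = constant-coordinate⇒dim≤ {g = to} pc to-ham f s (λ v Vv → proj₂ (to-Vtx v Vv))
  far-from-w : (∃ λ h → Halfspace W f s h × ham h (to w) ≡ suc (ham (to u) (to w))) →
               ∃ λ h → V h × ham h w ≡ suc (ham u w)
  far-from-w (h , Hh , far) = from h , from-Vtx h Hh , (begin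
    ham (from h) w            ≡⟨ sym (to-ham _ _ (from-Vtx h Hh) Vw) ⟩
    ham (to (from h)) (to w)  ≡⟨ cong (λ t → ham t (to w)) (to-from h Hh) ⟩
    ham h (to w)              ≡⟨ far ⟩
    suc (ham (to u) (to w))   ≡⟨ cong suc (to-ham u w Vu Vw) ⟩
    suc (ham u w)             ∎)
  far-from-u : (∃ λ h → Halfspace W f s h × ham (to u) h ≡ m) → ∃ λ h → V h × ham u h ≡ suc n
  far-from-u (h , Hh , far) = from h , from-Vtx h Hh ,
    ≤-antisym (ham≤dim u (from h)) (≤-trans n<m (≤-reflexive (begin
      m                         ≡⟨ sym far ⟩
      ham (to u) h              ≡⟨ cong (ham (to u)) (sym (to-from h Hh)) ⟩
      ham (to u) (to (from h))  ≡⟨ to-ham u (from h) Vu (from-Vtx h Hh) ⟩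
      ham u (from h)            ∎)))

module Contraction {n} (V : Cube (suc n) → Set) (e : Fin (suc n)) where

  G : Graph (suc n)
  G = Induced V

  C : Graph n
  C = Contract e V

  π : Cube (suc n) → Cube n
  π = πv e

  open ≡-Reasoning

  contract-unitEdges : UnitEdges C
  contract-unitEdges _ _ (u , v , (_ , _ , uv) , same , refl , refl) = begin
    ham (π u) (π v)                               ≡⟨ cong (_+ ham (π u) (π v)) (sym δ≡0) ⟩
    δ (lookup u e) (lookup v e) + ham (π u) (π v) ≡⟨ sym (ham-removeAt u v e) ⟩
    ham u v                                       ≡⟨ uv ⟩
    1                                             ∎
    where
    δ≡0 : δ (lookup u e) (lookup v e) ≡ 0
    δ≡0 = trans (cong (δ (lookup u e)) (sym same)) (δ-refl (lookup u e))

  edge-across-e-collapses : ∀ {u v} → Adj G u v → lookup u e ≢ lookup v e → π u ≡ π v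
  edge-across-e-collapses {u} {v} (_ , _ , uv) differ = ham≡0⇒≡ (π u) (π v) (suc-injective (begin
    1 + ham (π u) (π v)                           ≡⟨ cong (_+ ham (π u) (π v)) (sym (≢⇒δ≡1 differ)) ⟩
    δ (lookup u e) (lookup v e) + ham (π u) (π v) ≡⟨ sym (ham-removeAt u v e) ⟩
    ham u v                                       ≡⟨ uv ⟩
    1                                             ∎))

  -- Edges of E_e are dropped, and a walk whose ends are separated by e crosses E_e at least once.
  Projection : ∀ {ℓ u w} → Walk G ℓ u w → Set
  Projection {ℓ} {u} {w} p = ∃ λ ℓ′ → Σ (Walk C ℓ′ (π u) (π w)) λ p′ →
    δ (lookup u e) (lookup w e) + ℓ′ ≤ ℓ × (∀ y → OnWalk y p → OnWalk (π y) p′)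

  project : ∀ {ℓ u w} (p : Walk G ℓ u w) → Projection p
  project (here {u} Vu) =
    0 , here (u , Vu , refl) , ≤-reflexive (trans (+-identityʳ _) (δ-refl (lookup u e))) ,
    λ { _ on-here → on-here }
  project (step {u = u} {v} a p) = project-step a p (project p) (lookup u e ≟ lookup v e)
    where
    project-step : ∀ {ℓ u v w} (a : Adj G u v) (p : Walk G ℓ v w) → Projection p →
                   Dec (lookup u e ≡ lookup v e) → Projection (step a p)
    project-step {u = u} {v} a p (ℓ′ , p′ , bound , on) (yes same) =
      suc ℓ′ , step (u , v , a , same , refl , refl) p′ ,
      ≤-trans (≤-reflexive (+-suc _ ℓ′)) (s≤s (subst (λ b → δ b _ + ℓ′ ≤ _) (sym same) bound)) ,
      λ { _ on-start → on-start ; y (on-later y∈p) → on-later (on y y∈p) }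
    project-step {u = u} {v} {w} a p (ℓ′ , p′ , bound , on) (no differ) =
      ℓ′ , subst (λ t → Walk C ℓ′ t (π w)) (sym collapse) p′ ,
      +-mono-≤ (δ≤1 (lookup u e) (lookup w e)) (m+n≤o⇒n≤o (δ (lookup v e) (lookup w e)) bound) ,
      λ { _ on-start → onWalk-start _ ; y (on-later y∈p) → onWalk-subst (sym collapse) p′ (on y y∈p) }
      where
      collapse = edge-across-e-collapses a differ

  project-geodesic : ∀ {ℓ u w} (p : Walk G ℓ u w) → ℓ ≤ ham u w →
    ∃ λ ℓ′ → Σ (Walk C ℓ′ (π u) (π w)) λ p′ →
      ℓ′ ≤ ham (π u) (π w) × (∀ y → OnWalk y p → OnWalk (π y) p′)
  project-geodesic {u = u} {w} p ℓ≤ham with project p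
  ... | ℓ′ , p′ , bound , on =
    ℓ′ , p′ , +-cancelˡ-≤ (δ (lookup u e) (lookup w e)) _ _
                (≤-trans bound (≤-trans ℓ≤ham (≤-reflexive (ham-removeAt u w e)))) , on

  antipode-contracts : Isometric V → ∀ {u} → IsAntipode G u → IsAntipode C (π u)
  antipode-contracts isoV {u} (Vu , v , Vv , interval) =
    (u , Vu , refl) , π v , (v , Vv , refl) , λ { _ (y , Vy , refl) → projected-interval y Vy }
    where
    projected-interval : ∀ y → V y → InInterval C (π u) (π v) (π y)
    projected-interval y Vy with interval y Vy
    ... | _ , p , p-shortest , y∈p with project-geodesic p (p-shortest _ (geodesic isoV Vu Vv))
    ... | ℓ′ , p′ , ℓ′≤ham , on =
      ℓ′ , p′ , length≤ham⇒shortest contract-unitEdges p′ ℓ′≤ham , on y y∈p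

  contracted-interval⇒between : Isometric V → ∀ {u w x} → V u → V w →
                                InInterval C (π u) (π w) x → Between (π u) x (π w)
  contracted-interval⇒between isoV Vu Vw x∈interval with project-geodesic (geodesic isoV Vu Vw) ≤-refl
  ... | _ , p′ , ℓ′≤ham , _ = interval⇒between contract-unitEdges p′ ℓ′≤ham x∈interval

  contracted-antipodes-opposite : IsPartialCube V → ∀ {u w} → V u → V w →
    (∀ x → Vtx C x → InInterval C (π u) (π w) x) → ham (π u) (π w) ≡ n
  contracted-antipodes-opposite pc@(isoV , _) {u} {w} Vu Vw interval with ham≡dim⊎agree (π u) (π w)
  ... | inj₁ opposite     = opposite
  ... | inj₂ (i , agree) =
    ⊥-elim (n≮n n (constant-coordinate⇒dim≤ {g = id} pc (λ _ _ _ _ → refl)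
                                             (punchIn e i) (lookup (π u) i) constant))
    where
    -- all of V lies in the interval [π u, π w], so coordinate i of the contraction is constant
    constant : ∀ y → V y → lookup y (punchIn e i) ≡ lookup (π u) i
    constant y Vy = trans (sym (lookup-removeAt y e i))
      (between⇒agree (π u) (π y) (π w) i
        (contracted-interval⇒between isoV Vu Vw (interval (π y) (y , Vy , refl))) agree)

  contracted-antipode-lifts : IsPartialCube V → IsAffine V → ∀ {u w} → V u → V w →
    ham (π u) (π w) ≡ n → ∃ λ h → IsAntipode G h × π h ≡ π u
  contracted-antipode-lifts pc@(isoV , _) affine {u} {w} Vu Vw opposite
    with lookup u e ≟ lookup w e
  ... | no differ = u , ham≡dim⇒antipode isoV Vu Vw uw≡dim , refl
    where
    uw≡dim : ham u w ≡ suc n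
    uw≡dim = trans (ham-removeAt u w e) (cong₂ _+_ (≢⇒δ≡1 differ) opposite)
  ... | yes same with affine-far-vertex pc affine Vu Vw
  ...   | inj₂ (h , Vh , uh≡dim) = u , ham≡dim⇒antipode isoV Vu Vh uh≡dim , refl
  ...   | inj₁ (h , Vh , hw≡uw+1) = h , ham≡dim⇒antipode isoV Vh Vw hw≡dim , πh≡πu
    where
    hw≡dim : ham h w ≡ suc n
    hw≡dim = trans hw≡uw+1 (cong suc (trans (ham-removeAt u w e)
      (cong₂ _+_ (trans (cong (δ (lookup u e)) (sym same)) (δ-refl (lookup u e))) opposite)))
    πh≡πu : π h ≡ π u
    πh≡πu = begin
      π h               ≡⟨ cong π (ham≡dim⇒≡flip w h (trans (ham-sym w h) hw≡dim)) ⟩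
      π (flip w)        ≡⟨ removeAt-map not w e ⟩
      flip (π w)        ≡⟨ cong flip (ham≡dim⇒≡flip (π u) (π w) opposite) ⟩
      flip (flip (π u)) ≡⟨ flip-involutive (π u) ⟩
      π u               ∎

lemma33 : ∀ n (V : Cube (suc n) → Set) → IsPartialCube V → IsAffine V → (e : Fin (suc n)) →
    ∀ (x : Cube n) →
      (IsAntipode (Contract e V) x → ∃ λ u → IsAntipode (Induced V) u × πv e u ≡ x) ×
      ((∃ λ u → IsAntipode (Induced V) u × πv e u ≡ x) → IsAntipode (Contract e V) x)
lemma33 n V pc affine e x = lift , contract
  where
  open Contraction V e
  lift : IsAntipode C x → ∃ λ u → IsAntipode G u × π u ≡ x
  lift ((u , Vu , refl) , _ , (w , Vw , refl) , interval) =
    contracted-antipode-lifts pc affine Vu Vw (contracted-antipodes-opposite pc Vu Vw interval)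
  contract : (∃ λ u → IsAntipode G u × π u ≡ x) → IsAntipode C x
  contract (u , u-antipode , refl) = antipode-contracts (proj₁ pc) u-antipode
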